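{- Let $\mathfrak M=\langle\mathfrak F,V\rangle$ be a $\Box\Diamond^{ -1}$-model. For each formula $\varphi$, $\|\varphi\|_{\mathfrak M}\in FP_{\mathfrak F}$.
   Context: Formulas are built from propositional letters and $\bot$ using $\land,\lor,\to$. For a frame $\mathfrak F=\langle W,R\rangle$ and $X\subseteq W$: $\Box_{\mathfrak F}X=\{w\mid\forall v(wRv\Rightarrow v\in X)\}$ and $\Diamond^{ -1}_{\mathfrak F}X=\{w\in W\mid\exists x\in X,\ xRw\}$. $FP_{\mathfrak F}=\{\Box_{\mathfrak F}X\mid X\subseteq W\}$ is the set of fixpoints of the closure operator $\Box_{\mathfrak F}\Diamond^{ -1}_{\mathfrak F}$. A $\Box\Diamond^{ -1}$-model is a Kripke model $\langle\mathfrak F,V\rangle$ with $V(p)\in FP_{\mathfrak F}$ for every propositional letter $p$. Truth sets: $\|p\|=V(p)$, $\|\bot\|=\Box_{\mathfrak F}\emptyset$, $\|\alpha\land\beta\|=\|\alpha\|\cap\|\beta\|$, $\|\alpha\to\beta\|=\Box_{\mathfrak F}((W\setminus\|\alpha\|)\cup\|\beta\|)$, $\|\alpha\lor\beta\|=\Box_{\mathfrak F}\Diamond^{ -1}_{\mathfrak F}(\|\alpha\|\cup\|\beta\|)$. -}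

module Defs where

open import Level using (Level; _⊔_; suc)
open import Data.Nat using (ℕ)
open import Data.Product using (Σ; ∃; _×_; _,_)
open import Data.Sum using (_⊎_)
open import Data.Empty.Polymorphic using (⊥)
open import Relation.Unary using (Pred; _⊆_; _∈_; _∉_)

data Formula : Set where
  var  : ℕ → Formula
  bot  : Formula
  _∧_  : Formula → Formula → Formula
  _∨_  : Formula → Formula → Formula
  _⇒_  : Formula → Formula → Formula

record Frame (ℓ : Level) : Set (suc ℓ) where
  field
    W : Set ℓ
    R : W → W → Set ℓ

module _ {ℓ : Level} (F : Frame ℓ) where
  open Frame F

  Box : Pred W ℓ → Pred W ℓ
  Box X w = ∀ v → R w v → X v

  Dia⁻¹ : Pred W ℓ → Pred W ℓ
  Dia⁻¹ X w = Σ W (λ x → X x × R x w)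

  _≐_ : Pred W ℓ → Pred W ℓ → Set ℓ
  X ≐ Y = (X ⊆ Y) × (Y ⊆ X)

  InFP : Pred W ℓ → Set (suc ℓ)
  InFP X = Σ (Pred W ℓ) (λ Y → X ≐ Box Y)

  Compl : Pred W ℓ → Pred W ℓ
  Compl X w = X w → ⊥ {ℓ}

  Union : Pred W ℓ → Pred W ℓ → Pred W ℓ
  Union X Y w = X w ⊎ Y w

  Empty : Pred W ℓ
  Empty _ = ⊥ {ℓ}

record BDModel (ℓ : Level) : Set (suc ℓ) where
  field
    frame  : Frame ℓ
    V      : ℕ → Pred (Frame.W frame) ℓ
    V-FP   : ∀ p → InFP frame (V p)

module _ {ℓ : Level} (M : BDModel ℓ) where
  open BDModel M

  ⟦_⟧ : Formula → Pred (Frame.W frame) ℓ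
  ⟦ var p ⟧   = V p
  ⟦ bot ⟧     = Box frame (Empty frame)
  ⟦ φ ∧ ψ ⟧   = λ w → ⟦ φ ⟧ w × ⟦ ψ ⟧ w
  ⟦ φ ⇒ ψ ⟧   = Box frame (Union frame (Compl frame ⟦ φ ⟧) ⟦ ψ ⟧)
  ⟦ φ ∨ ψ ⟧   = Box frame (Dia⁻¹ frame (Union frame ⟦ φ ⟧ ⟦ ψ ⟧))

{-# OPTIONS --safe #-}
module Submission where

-- Every connective other than ∧ is interpreted as a box, so its truth set is in FP
-- by definition; for ∧ use that □ X ∩ □ Y = □ (X ∩ Y).

open import Level using (Level)
open import Function using (id; _∘_)
open import Data.Product using (_,_; proj₁; proj₂; map)
open import Relation.Unary using (Pred; _∩_)
open import Defs

module _ {ℓ : Level} (F : Frame ℓ) where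
  open Frame F

  Box-inFP : (X : Pred W ℓ) → InFP F (Box F X)
  Box-inFP X = X , id , id

  Box-∩ : (X Y : Pred W ℓ) → _≐_ F (Box F X ∩ Box F Y) (Box F (X ∩ Y))
  Box-∩ X Y =
    (λ (□X , □Y) v wRv → □X v wRv , □Y v wRv) ,
    (λ □XY → (λ v wRv → proj₁ (□XY v wRv)) , (λ v wRv → proj₂ (□XY v wRv)))

  ∩-inFP : {X Y : Pred W ℓ} → InFP F X → InFP F Y → InFP F (X ∩ Y)
  ∩-inFP (X′ , X⊆□X′ , □X′⊆X) (Y′ , Y⊆□Y′ , □Y′⊆Y) =
    X′ ∩ Y′ ,
    proj₁ (Box-∩ X′ Y′) ∘ map X⊆□X′ Y⊆□Y′ ,
    map □X′⊆X □Y′⊆Y ∘ proj₂ (Box-∩ X′ Y′)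

lemma1 : ∀ {ℓ : Level} (M : BDModel ℓ) (φ : Formula) → InFP (BDModel.frame M) (⟦ M ⟧ φ)
lemma1 M (var p) = BDModel.V-FP M p
lemma1 M bot     = Box-inFP _ _
lemma1 M (φ ∧ ψ) = ∩-inFP _ (lemma1 M φ) (lemma1 M ψ)
lemma1 M (φ ∨ ψ) = Box-inFP _ _
lemma1 M (φ ⇒ ψ) = Box-inFP _ _
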